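{- Let $G=(V,E)$ be a finite simple undirected graph, let $S_{cyc}\subseteq\{0,1\}^E$ be the set of orientations of $G$ containing a directed cycle and $\overline{S_{cyc}}=\{0,1\}^E\setminus S_{cyc}$. Then (i) $\{X\subseteq E : E\setminus X\text{ intersects (the edge set of) some cycle of }G\}\supseteq\mathrm{str}(S_{cyc})$; (ii) $\{X\subseteq E : \text{every edge of }X\text{ is a bridge of }G\}\subseteq\mathrm{sstr}(\overline{S_{cyc}})$.
   Context: Fix an arbitrary reference direction for each edge of $G$. An orientation of $G$ is a function $f\in\{0,1\}^E$; $\vec G^f$ is the digraph obtained by directing each edge $e$ along its reference direction if $f(e)=0$ and against it if $f(e)=1$. A bridge is an edge contained in no cycle. For disjoint sets $A,B$ and $g\in\{0,1\}^A$, $h\in\{0,1\}^B$, $g\star h\in\{0,1\}^{A\cup B}$ is the function agreeing with $g$ on $A$ and with $h$ on $B$. For $S\subseteq\{0,1\}^E$ and $Y\subseteq E$: $S$ shatters $Y$ if for every $h\in\{0,1\}^Y$ there exists $g\in\{0,1\}^{E\setminus Y}$ with $g\star h\in S$; $S$ strongly shatters $Y$ if there exists $g\in\{0,1\}^{E\setminus Y}$ such that $g\star h\in S$ for every $h\in\{0,1\}^Y$. $\mathrm{str}(S)$ and $\mathrm{sstr}(S)$ denote the families of subsets of $E$ shattered, respectively strongly shattered, by $S$. -}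

module Defs where

open import Data.Nat using (ℕ; suc)
open import Data.Fin using (Fin; zero; suc; inject₁; fromℕ)
open import Data.Bool using (Bool; true; false; if_then_else_)
open import Data.Product using (Σ; ∃; ∃-syntax; _×_; _,_)
open import Data.Sum using (_⊎_)
open import Relation.Binary.PropositionalEquality using (_≡_; _≢_)
open import Relation.Nullary using (¬_)
open import Function.Definitions using (Injective)

-- Each edge e has endpoints src e and tgt e; the pair (src e , tgt e) is the
-- fixed (arbitrary) reference direction of e.
record Graph : Set where
  field
    n m   : ℕ
    src   : Fin m → Fin n
    tgt   : Fin m → Fin n
    loopless : ∀ e → src e ≢ tgt e
    simple : ∀ e e' →
      ((src e ≡ src e' × tgt e ≡ tgt e') ⊎ (src e ≡ tgt e' × tgt e ≡ src e')) →
      e ≡ e'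

module _ (G : Graph) where
  open Graph G

  -- Tail / head of edge e when traversed in direction d
  -- (false = along the reference direction, true = against it).
  tailOf : Fin m → Bool → Fin n
  tailOf e d = if d then tgt e else src e

  headOf : Fin m → Bool → Fin n
  headOf e d = if d then src e else tgt e

  record Cycle : Set where
    field
      k    : ℕ
      edge : Fin (suc k) → Fin m
      dir  : Fin (suc k) → Bool
      edge-inj   : Injective _≡_ _≡_ edge
      vertex-inj : Injective _≡_ _≡_ (λ i → tailOf (edge i) (dir i))
      step  : ∀ (i : Fin k) →
        headOf (edge (inject₁ i)) (dir (inject₁ i)) ≡ tailOf (edge (suc i)) (dir (suc i))
      close : headOf (edge (fromℕ k)) (dir (fromℕ k)) ≡ tailOf (edge zero) (dir zero)

  _∈C_ : Fin m → Cycle → Set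
  e ∈C C = ∃[ i ] Cycle.edge C i ≡ e

  -- Subsets of E are represented by characteristic functions; an element
  -- of {0,1}^E by a function Fin m → Bool (false = 0, true = 1).
  EdgeSet : Set
  EdgeSet = Fin m → Bool

  Orientation : Set
  Orientation = Fin m → Bool

  DirectedCycle : Orientation → Set
  DirectedCycle f = Σ Cycle λ C → ∀ i → Cycle.dir C i ≡ f (Cycle.edge C i)

  Scyc : Orientation → Set
  Scyc f = DirectedCycle f

  coScyc : Orientation → Set
  coScyc f = ¬ Scyc f

  -- g ⋆ h for g on E∖Y and h on Y (values of g on Y / h off Y are ignored).
  star : EdgeSet → Orientation → Orientation → Orientation
  star Y g h e = if Y e then h e else g e

  Shatters : (Orientation → Set) → EdgeSet → Set
  Shatters S Y = ∀ (h : Orientation) → ∃[ g ] S (star Y g h)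

  StronglyShatters : (Orientation → Set) → EdgeSet → Set
  StronglyShatters S Y = ∃[ g ] ∀ (h : Orientation) → S (star Y g h)

  Bridge : Fin m → Set
  Bridge e = ∀ (C : Cycle) → ¬ (e ∈C C)

module Submission where

-- Rank the vertices of G by their index and orient every edge
-- from its lower to its higher endpoint ("ascending orientation").  Along any
-- directed cycle of an orientation in which every edge climbs in rank, the
-- rank of the tail vertices strictly increases, yet the cycle returns to its
-- first vertex; so such an orientation is acyclic.  Whether a cycle C is
-- directed in an orientation only depends on the orientation's values on the
-- edges of C.  Both parts then follow from the ascending orientation:
--  (i)  if S_cyc shatters X, some g ⋆ ascending has a directed cycle C; were
--       all edges of C in X, C would be directed in the ascending orientation
--       itself, so some edge of C lies outside X;
--  (ii) if X consists of bridges, ascending ⋆ h agrees with the ascending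
--       orientation on the edges of every cycle (they avoid X), so it is
--       acyclic for every h: the ascending orientation witnesses strong
--       shattering of X by the complement of S_cyc.

open import Defs
open import Data.Bool using (true; false; T; _≟_)
open import Data.Bool.Properties using (¬-not)
open import Data.Empty using (⊥-elim)
open import Data.Fin using (Fin; zero; suc; toℕ; inject₁; fromℕ)
open import Data.Fin.Induction using (<-weakInduction)
import Data.Fin.Properties as FinP
open import Data.Nat using (ℕ; suc; _<_; _≤_; _<ᵇ_)
import Data.Nat.Properties as ℕP
open import Data.Product using (_×_; ∃-syntax; _,_)
open import Data.Sum using (_⊎_; inj₁; inj₂)
open import Data.Unit using (tt)
open import Relation.Binary.PropositionalEquality using (_≡_; refl; sym; trans; cong; subst)
open import Relation.Nullary using (¬_; yes; no)

module _ (G : Graph) where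
  open Graph G

  Climbs : (Fin n → ℕ) → Orientation G → Set
  Climbs r f = ∀ e → r (tailOf G e (f e)) < r (headOf G e (f e))

  -- No cycle can be traversed so that every one of its edges climbs in rank:
  -- the ranks of the successive tails increase, but the cycle closes up.
  no-climbing-cycle : (r : Fin n → ℕ) (C : Cycle G) →
    ¬ (∀ i → r (tailOf G (Cycle.edge C i) (Cycle.dir C i))
             < r (headOf G (Cycle.edge C i) (Cycle.dir C i)))
  no-climbing-cycle r C climb = ℕP.<-irrefl (sym closes) (ℕP.≤-<-trans (first≤ (fromℕ k)) (climb (fromℕ k)))
    where
      open Cycle C
      tail-rank : Fin (suc k) → ℕ
      tail-rank i = r (tailOf G (edge i) (dir i))

      -- the head of edge i is the tail of edge i+1, so tail ranks increase
      first≤ : ∀ i → tail-rank zero ≤ tail-rank i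
      first≤ = <-weakInduction (λ i → tail-rank zero ≤ tail-rank i) ℕP.≤-refl
        (λ j ih → ℕP.≤-trans ih (ℕP.<⇒≤ (subst (tail-rank (inject₁ j) <_) (cong r (step j)) (climb (inject₁ j)))))

      closes : r (headOf G (edge (fromℕ k)) (dir (fromℕ k))) ≡ tail-rank zero
      closes = cong r close

  climbing-acyclic : (r : Fin n → ℕ) (f : Orientation G) → Climbs r f → coScyc G f
  climbing-acyclic r f climbs (C , along) = no-climbing-cycle r C climb
    where
      climb : ∀ i → r (tailOf G (Cycle.edge C i) (Cycle.dir C i))
                  < r (headOf G (Cycle.edge C i) (Cycle.dir C i))
      climb i rewrite along i = climbs (Cycle.edge C i)

  -- The ascending orientation: each edge points to its endpoint of larger index
  -- (the reference direction is reversed exactly when tgt e < src e).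
  ascending : Orientation G
  ascending e = toℕ (tgt e) <ᵇ toℕ (src e)

  -- It climbs the index rank; looplessness makes the comparison strict.
  ascending-climbs : Climbs toℕ ascending
  ascending-climbs e with toℕ (tgt e) <ᵇ toℕ (src e) in cmp
  ... | true  = ℕP.<ᵇ⇒< (toℕ (tgt e)) (toℕ (src e)) (subst T (sym cmp) tt)
  ... | false with ℕP.m≤n⇒m<n∨m≡n (ℕP.≮⇒≥ (λ tgt<src → subst T cmp (ℕP.<⇒<ᵇ tgt<src)))
  ...   | inj₁ src<tgt = src<tgt
  ...   | inj₂ src≡tgt = ⊥-elim (loopless e (FinP.toℕ-injective src≡tgt))

  ascending-acyclic : coScyc G ascending
  ascending-acyclic = climbing-acyclic toℕ ascending ascending-climbs

  directed-transfer : (f f' : Orientation G) (C : Cycle G) →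
    (∀ i → f (Cycle.edge C i) ≡ f' (Cycle.edge C i)) →
    (∀ i → Cycle.dir C i ≡ f (Cycle.edge C i)) →
    DirectedCycle G f'
  directed-transfer f f' C agree along = C , λ i → trans (along i) (agree i)

  star-in : (Y : EdgeSet G) (g h : Orientation G) {e : Fin m} → Y e ≡ true → star G Y g h e ≡ h e
  star-in Y g h inY rewrite inY = refl

  star-out : (Y : EdgeSet G) (g h : Orientation G) {e : Fin m} → Y e ≡ false → star G Y g h e ≡ g e
  star-out Y g h outY rewrite outY = refl

  leaves-or-inside : (X : EdgeSet G) (C : Cycle G) →
    (∃[ i ] X (Cycle.edge C i) ≡ false) ⊎ (∀ i → X (Cycle.edge C i) ≡ true)
  leaves-or-inside X C with FinP.any? (λ i → X (Cycle.edge C i) ≟ false)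
  ... | yes leaves = inj₁ leaves
  ... | no ¬leaves = inj₂ λ i → ¬-not (λ out → ¬leaves (i , out))

  bridges-off-cycles : (X : EdgeSet G) → (∀ e → X e ≡ true → Bridge G e) →
    (C : Cycle G) (i : Fin (suc (Cycle.k C))) → X (Cycle.edge C i) ≡ false
  bridges-off-cycles X bridges C i with X (Cycle.edge C i) in inX
  ... | false = refl
  ... | true  = ⊥-elim (bridges _ inX C (i , refl))

lemma3p7 : (G : Graph) →
    (∀ (X : EdgeSet G) → Shatters G (Scyc G) X →
      ∃[ C ] ∃[ e ] (X e ≡ false × _∈C_ G e C))
    × (∀ (X : EdgeSet G) → (∀ e → X e ≡ true → Bridge G e) →
      StronglyShatters G (coScyc G) X)
lemma3p7 G = shattered-meets-complement , bridges-strongly-shattered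
  where
  -- (i): shattering yields a directed cycle of g ⋆ ascending, which must leave X.
  shattered-meets-complement : ∀ (X : EdgeSet G) → Shatters G (Scyc G) X →
    ∃[ C ] ∃[ e ] (X e ≡ false × _∈C_ G e C)
  shattered-meets-complement X shatters with shatters (ascending G)
  ... | g , C , along with leaves-or-inside G X C
  ...   | inj₁ (i , out) = C , Cycle.edge C i , out , i , refl
  ...   | inj₂ inside    = ⊥-elim (ascending-acyclic G
            (directed-transfer G (star G X g (ascending G)) (ascending G) C
              (λ i → star-in G X g (ascending G) (inside i)) along))

  -- (ii): cycles avoid the bridges in X, so ascending ⋆ h is acyclic for all h.
  bridges-strongly-shattered : ∀ (X : EdgeSet G) → (∀ e → X e ≡ true → Bridge G e) →
    StronglyShatters G (coScyc G) X
  bridges-strongly-shattered X bridges = ascending G , λ h (C , along) →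
    ascending-acyclic G (directed-transfer G (star G X (ascending G) h) (ascending G) C
        (λ i → star-out G X (ascending G) h (bridges-off-cycles G X bridges C i)) along)
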